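{- Let $R$ be a commutative ring and let $G$ be a tree with an edge labeling $\alpha$ over $R$. Then $(G,\alpha)$ satisfies the Universal Difference Property.
   Context: Graphs are finite. An edge labeling of a graph $G=(V,E)$ over a commutative ring $R$ is a function $\alpha:E\to\mathcal{I}(R)$ assigning to each edge an ideal of $R$. A (generalized) spline on $(G,\alpha)$ is a function $\rho:V\to R$ such that for each edge $ab$, $\rho(a)-\rho(b)\in\alpha(ab)$. For vertices $u,w$, $\mathcal{P}_{(u,w)}$ denotes the set of all paths in $G$ from $u$ to $w$, and for a path $P$ with edges $e_1,\dots,e_k$, $\alpha(P)=\alpha(e_1)+\cdots+\alpha(e_k)$. $(G,\alpha)$ satisfies the Universal Difference Property (UDP) if for every pair of vertices $u,w$ connected by a path in $G$ and every $x\in\bigcap_{P\in\mathcal{P}_{(u,w)}}\alpha(P)$ there exists a spline $\rho$ on $(G,\alpha)$ with $\rho(u)-\rho(w)=x$. -}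

module Defs where

open import Level using (Level; _⊔_; suc)
open import Data.Nat using (ℕ; zero; suc; _≤_)
open import Data.Fin using (Fin)
open import Data.Product using (Σ; ∃; ∃-syntax; _×_; _,_; proj₁; proj₂)
open import Data.Sum using (_⊎_)
open import Data.List using (List; []; _∷_; length)
open import Data.List.Relation.Unary.Unique.Propositional using (Unique)
open import Relation.Binary.PropositionalEquality using (_≡_)
open import Relation.Nullary using (¬_)
open import Algebra.Bundles using (CommutativeRing)

record Ideal {c ℓ : Level} (R : CommutativeRing c ℓ) (p : Level) : Set (c ⊔ ℓ ⊔ Level.suc p) where
  open CommutativeRing R
  field
    _∈I    : Carrier → Set p
    resp   : ∀ {x y} → x ≈ y → x ∈I → y ∈I
    0∈     : 0# ∈I
    +-closed : ∀ {x y} → x ∈I → y ∈I → (x + y) ∈I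
    *-closed : ∀ r {x} → x ∈I → (r * x) ∈I

-- Finite (multi)graphs: vertices Fin n, edges Fin m, each edge has
-- two (unordered) endpoints given by `ends`.

record Graph : Set where
  field
    n    : ℕ
    m    : ℕ
    ends : Fin m → Fin n × Fin n

module _ (G : Graph) where
  open Graph G

  Joins : Fin m → Fin n → Fin n → Set
  Joins e a b = (ends e ≡ (a , b)) ⊎ (ends e ≡ (b , a))

  data Walk : Fin n → Fin n → Set where
    []  : ∀ {a} → Walk a a
    _∷⟨_⟩_ : ∀ {a b c} (e : Fin m) → Joins e a b → Walk b c → Walk a c

  vertices : ∀ {a b} → Walk a b → List (Fin n)
  vertices {a} []            = a ∷ []
  vertices {a} (e ∷⟨ _ ⟩ w)  = a ∷ vertices w

  initVertices : ∀ {a b} → Walk a b → List (Fin n)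
  initVertices []                = []
  initVertices {a} (e ∷⟨ _ ⟩ w)  = a ∷ initVertices w

  edges : ∀ {a b} → Walk a b → List (Fin m)
  edges []            = []
  edges (e ∷⟨ _ ⟩ w)  = e ∷ edges w

  IsPath : ∀ {a b} → Walk a b → Set
  IsPath w = Unique (vertices w)

  Path : Fin n → Fin n → Set
  Path u w = Σ (Walk u w) IsPath

  IsCycle : ∀ {a} → Walk a a → Set
  IsCycle w = (1 ≤ length (edges w)) × Unique (edges w) × Unique (initVertices w)

  Connected : Set
  Connected = ∀ u w → Path u w

  Acyclic : Set
  Acyclic = ∀ a (w : Walk a a) → ¬ IsCycle w

  IsTree : Set
  IsTree = Connected × Acyclic

module _ {c ℓ p : Level} (R : CommutativeRing c ℓ) (G : Graph) where
  open CommutativeRing R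
  open Graph G
  open Ideal

  EdgeLabeling : Set (c ⊔ ℓ ⊔ Level.suc p)
  EdgeLabeling = Fin m → Ideal R p

  IsSpline : EdgeLabeling → (Fin n → Carrier) → Set p
  IsSpline α ρ = ∀ (e : Fin m) → _∈I (α e) (ρ (proj₁ (ends e)) - ρ (proj₂ (ends e)))

  -- x ∈ α(P) = α(e₁) + ⋯ + α(e_k)  (the empty sum is the zero ideal)
  InPathIdeal : EdgeLabeling → ∀ {a b} → Walk G a b → Carrier → Set (c ⊔ ℓ ⊔ p)
  InPathIdeal α []              x = Level.Lift (c ⊔ p) (x ≈ 0#)
  InPathIdeal α (e ∷⟨ _ ⟩ w)    x =
    Σ Carrier λ y → Σ Carrier λ z → _∈I (α e) y × InPathIdeal α w z × (x ≈ y + z)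

  UDP : EdgeLabeling → Set (c ⊔ ℓ ⊔ p)
  UDP α = ∀ (u w : Fin n) → Path G u w →
          ∀ (x : Carrier) →
          (∀ (P : Path G u w) → InPathIdeal α (proj₁ P) x) →
          Σ (Fin n → Carrier) λ ρ → IsSpline α ρ × ((ρ u - ρ w) ≈ x)

module Submission where

-- Root the tree at w and write x = Σ y_e with y_e ∈ α(e), e running over the
-- unique u–w path P.  Let ρ(v) be the sum of those y_e for which e lies on the
-- path from v to the root.  Then ρ(w) = 0 and ρ(u) = x, and for an edge f = ab
-- the root paths of a and b differ by exactly the edge f, so ρ(a) − ρ(b) is 0
-- or ±y_f, an element of α(f).  Uniqueness of paths comes from acyclicity: two
-- paths leaving a vertex along different edges close up, after shortcutting,
-- to a cycle.

open import Defs
open import Level using (Level)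
open import Algebra.Bundles using (CommutativeRing)

open import Data.Nat using (z≤n; s≤s)
open import Data.Fin using (Fin)
open import Data.Fin.Properties using (_≟_)
open import Data.Product using (∃; _×_; _,_; proj₁; proj₂)
open import Data.Sum using (_⊎_; inj₁; inj₂)
open import Data.Empty using (⊥-elim)
open import Data.List using (List; []; _∷_; _++_)
open import Data.List.Relation.Unary.Any using (here; there)
open import Data.List.Relation.Unary.All using ([])
open import Data.List.Relation.Unary.All.Properties using (¬Any⇒All¬; All¬⇒¬Any)
open import Data.List.Relation.Unary.AllPairs using ([]; _∷_)
open import Data.List.Relation.Unary.Unique.Propositional using (Unique)
open import Data.List.Membership.Propositional using (_∈_; _∉_)
open import Data.List.Membership.Propositional.Properties using (∈-++⁺ʳ; ∈-++⁻)
open import Data.List.Relation.Binary.Subset.Propositional using (_⊆_)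
open import Relation.Binary.PropositionalEquality using (_≡_; _≢_; subst)
import Relation.Binary.PropositionalEquality as ≡
open import Relation.Nullary using (Dec; yes; no)
open import Function using (_∘′_)

module WalkProperties (G : Graph) where
  open Graph G
  open ≡ using (refl; sym; trans; cong)
  open import Data.List.Membership.DecPropositional (_≟_ {n}) using () renaming (_∈?_ to _∈ᵛ?_)

  source target : Fin m → Fin n
  source f = proj₁ (ends f)
  target f = proj₂ (ends f)

  Joins-sym : ∀ {e a b} → Joins G e a b → Joins G e b a
  Joins-sym (inj₁ eq) = inj₂ eq
  Joins-sym (inj₂ eq) = inj₁ eq

  Joins-functional : ∀ {e a c d} → Joins G e a c → Joins G e a d → c ≡ d
  Joins-functional (inj₁ j) (inj₁ k) = cong proj₂ (trans (sym j) k)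
  Joins-functional (inj₁ j) (inj₂ k) = trans (cong proj₂ (trans (sym j) k)) (cong proj₁ (trans (sym j) k))
  Joins-functional (inj₂ j) (inj₁ k) = trans (cong proj₁ (trans (sym j) k)) (cong proj₂ (trans (sym j) k))
  Joins-functional (inj₂ j) (inj₂ k) = cong proj₁ (trans (sym j) k)

  Joins-endpoint : ∀ {e a c x y} → Joins G e a c → Joins G e x y → a ≡ x ⊎ a ≡ y
  Joins-endpoint (inj₁ j) (inj₁ k) = inj₁ (cong proj₁ (trans (sym j) k))
  Joins-endpoint (inj₁ j) (inj₂ k) = inj₂ (cong proj₁ (trans (sym j) k))
  Joins-endpoint (inj₂ j) (inj₁ k) = inj₂ (cong proj₂ (trans (sym j) k))
  Joins-endpoint (inj₂ j) (inj₂ k) = inj₁ (cong proj₂ (trans (sym j) k))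

  infixr 5 _++ʷ_
  _++ʷ_ : ∀ {a b c} → Walk G a b → Walk G b c → Walk G a c
  [] ++ʷ q = q
  (e ∷⟨ j ⟩ p) ++ʷ q = e ∷⟨ j ⟩ (p ++ʷ q)

  edges-++ʷ : ∀ {a b c} (p : Walk G a b) (q : Walk G b c) → edges G (p ++ʷ q) ≡ edges G p ++ edges G q
  edges-++ʷ [] q = refl
  edges-++ʷ (e ∷⟨ j ⟩ p) q = cong (e ∷_) (edges-++ʷ p q)

  ∈-edges-++ʷ⁻ : ∀ {a b c e} (p : Walk G a b) (q : Walk G b c) →
                 e ∈ edges G (p ++ʷ q) → e ∈ edges G p ⊎ e ∈ edges G q
  ∈-edges-++ʷ⁻ p q e∈ = ∈-++⁻ (edges G p) (subst (_ ∈_) (edges-++ʷ p q) e∈)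

  reverseʷ : ∀ {a b} → Walk G a b → Walk G b a
  reverseʷ [] = []
  reverseʷ (e ∷⟨ j ⟩ p) = reverseʷ p ++ʷ e ∷⟨ Joins-sym j ⟩ []

  ∈-edges-reverseʷ⁻ : ∀ {a b e} (p : Walk G a b) → e ∈ edges G (reverseʷ p) → e ∈ edges G p
  ∈-edges-reverseʷ⁻ (e ∷⟨ j ⟩ p) e∈ with ∈-edges-++ʷ⁻ (reverseʷ p) (e ∷⟨ Joins-sym j ⟩ []) e∈
  ... | inj₁ e∈p = there (∈-edges-reverseʷ⁻ p e∈p)
  ... | inj₂ (here eq) = here eq

  start∈vertices : ∀ {a b} (p : Walk G a b) → a ∈ vertices G p
  start∈vertices [] = here refl
  start∈vertices (e ∷⟨ j ⟩ p) = here refl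

  end∈vertices : ∀ {a b} (p : Walk G a b) → b ∈ vertices G p
  end∈vertices [] = here refl
  end∈vertices (e ∷⟨ j ⟩ p) = there (end∈vertices p)

  initVertices⊆vertices : ∀ {a b} (p : Walk G a b) → initVertices G p ⊆ vertices G p
  initVertices⊆vertices (e ∷⟨ j ⟩ p) (here eq) = here eq
  initVertices⊆vertices (e ∷⟨ j ⟩ p) (there x∈) = there (initVertices⊆vertices p x∈)

  path⇒initVertices-unique : ∀ {a b} (p : Walk G a b) → IsPath G p →
                             Unique (initVertices G p) × b ∉ initVertices G p
  path⇒initVertices-unique [] _ = [] , λ ()
  path⇒initVertices-unique {a} {b} (e ∷⟨ j ⟩ p) (a∉p ∷ p-path) with path⇒initVertices-unique p p-path
  ... | init-unique , b∉init =
    ¬Any⇒All¬ _ (All¬⇒¬Any a∉p ∘′ initVertices⊆vertices p) ∷ init-unique , b∉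
    where
      b∉ : b ∉ a ∷ initVertices G p
      b∉ (here b≡a) = All¬⇒¬Any a∉p (subst (_∈ vertices G p) b≡a (end∈vertices p))
      b∉ (there b∈) = b∉init b∈

  endpoint∈vertices : ∀ {e a c x y} → Joins G e a c → (p : Walk G x y) →
                      e ∈ edges G p → a ∈ vertices G p
  endpoint∈vertices j (f ∷⟨ k ⟩ p) (here refl) with Joins-endpoint j k
  ... | inj₁ a≡x = here a≡x
  ... | inj₂ a≡y = there (subst (_∈ vertices G p) (sym a≡y) (start∈vertices p))
  endpoint∈vertices j (f ∷⟨ k ⟩ p) (there e∈) = there (endpoint∈vertices j p e∈)

  path⇒edges-unique : ∀ {a b} (p : Walk G a b) → IsPath G p → Unique (edges G p)
  path⇒edges-unique [] _ = []
  path⇒edges-unique (e ∷⟨ j ⟩ p) (a∉p ∷ p-path) =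
    ¬Any⇒All¬ _ (All¬⇒¬Any a∉p ∘′ endpoint∈vertices j p) ∷ path⇒edges-unique p p-path

  record PathSplit {a b} (p : Walk G a b) (v : Fin n) : Set where
    field
      prefix          : Walk G a v
      suffix          : Walk G v b
      prefix-path     : IsPath G prefix
      suffix-path     : IsPath G suffix
      edges-split     : edges G p ≡ edges G prefix ++ edges G suffix
      prefix-vertices : vertices G prefix ⊆ vertices G p

  splitPath : ∀ {a b v} (p : Walk G a b) → IsPath G p → v ∈ vertices G p → PathSplit p v
  splitPath [] p-path (here refl) = record
    { prefix = [] ; suffix = [] ; prefix-path = p-path ; suffix-path = p-path
    ; edges-split = refl ; prefix-vertices = λ x∈ → x∈ }
  splitPath (e ∷⟨ j ⟩ p) p-path (here refl) = record
    { prefix = [] ; suffix = e ∷⟨ j ⟩ p ; prefix-path = [] ∷ [] ; suffix-path = p-path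
    ; edges-split = refl ; prefix-vertices = λ { (here eq) → here eq } }
  splitPath (e ∷⟨ j ⟩ p) (a∉p ∷ p-path) (there v∈) = record
    { prefix = e ∷⟨ j ⟩ prefix ; suffix = suffix
    ; prefix-path = ¬Any⇒All¬ _ (All¬⇒¬Any a∉p ∘′ prefix-vertices) ∷ prefix-path
    ; suffix-path = suffix-path
    ; edges-split = cong (e ∷_) edges-split
    ; prefix-vertices = λ { (here eq) → here eq ; (there x∈) → there (prefix-vertices x∈) } }
    where open PathSplit (splitPath p p-path v∈)

  shortcut : ∀ {a b} (p : Walk G a b) → ∃ λ (q : Walk G a b) → IsPath G q × edges G q ⊆ edges G p
  shortcut [] = [] , [] ∷ [] , λ ()
  shortcut {a} (e ∷⟨ j ⟩ p) with shortcut p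
  ... | q , q-path , q⊆p with a ∈ᵛ? vertices G q
  ... | no a∉q = e ∷⟨ j ⟩ q , ¬Any⇒All¬ _ a∉q ∷ q-path ,
                 λ { (here eq) → here eq ; (there f∈) → there (q⊆p f∈) }
  ... | yes a∈q = suffix , suffix-path ,
                  λ f∈ → there (q⊆p (subst (_ ∈_) (sym edges-split) (∈-++⁺ʳ (edges G prefix) f∈)))
    where open PathSplit (splitPath q q-path a∈q)

module AcyclicProperties (G : Graph) (acyclic : Acyclic G) where
  open Graph G
  open ≡ using (refl; sym; cong)
  open WalkProperties G
  open import Data.List.Membership.DecPropositional (_≟_ {m}) using () renaming (_∈?_ to _∈ᵉ?_)

  closing-walk-uses-edge : ∀ {e a c} → Joins G e a c → (w : Walk G c a) → e ∈ edges G w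
  closing-walk-uses-edge {e} {a} j w with e ∈ᵉ? edges G w | shortcut w
  ... | yes e∈w | _ = e∈w
  ... | no e∉w  | q , q-path , q⊆w =
    ⊥-elim (acyclic a (e ∷⟨ j ⟩ q) (s≤s z≤n , edges-unique , initVertices-unique))
    where
      edges-unique : Unique (e ∷ edges G q)
      edges-unique = ¬Any⇒All¬ _ (e∉w ∘′ q⊆w) ∷ path⇒edges-unique q q-path
      initVertices-unique : Unique (a ∷ initVertices G q)
      initVertices-unique = ¬Any⇒All¬ _ (proj₂ (path⇒initVertices-unique q q-path))
                            ∷ proj₁ (path⇒initVertices-unique q q-path)

  no-self-loop : ∀ f → source f ≢ target f
  no-self-loop f loop with closing-walk-uses-edge {f} (inj₁ (cong (source f ,_) (sym loop))) []
  ... | ()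

  unique-path : ∀ {a b} (p q : Walk G a b) → IsPath G p → IsPath G q → edges G p ≡ edges G q
  unique-path [] [] _ _ = refl
  unique-path [] (f ∷⟨ k ⟩ q) _ (a∉q ∷ _) = ⊥-elim (All¬⇒¬Any a∉q (end∈vertices q))
  unique-path (e ∷⟨ j ⟩ p) [] (a∉p ∷ _) _ = ⊥-elim (All¬⇒¬Any a∉p (end∈vertices p))
  unique-path (e ∷⟨ j ⟩ p) (f ∷⟨ k ⟩ q) (a∉p ∷ p-path) (a∉q ∷ q-path) with e ≟ f
  ... | yes refl with Joins-functional j k
  ...   | refl = cong (e ∷_) (unique-path p q p-path q-path)
  unique-path {a} (_∷⟨_⟩_ {b = c} e j p) (f ∷⟨ k ⟩ q) (a∉p ∷ _) (a∉q ∷ _) | no e≢f =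
    ⊥-elim (e∉w (closing-walk-uses-edge j w))
    where
      w : Walk G c a
      w = p ++ʷ reverseʷ q ++ʷ f ∷⟨ Joins-sym k ⟩ []
      e∉w : e ∉ edges G w
      e∉w e∈w with ∈-edges-++ʷ⁻ p _ e∈w
      ... | inj₁ e∈p = All¬⇒¬Any a∉p (endpoint∈vertices j p e∈p)
      ... | inj₂ e∈rest with ∈-edges-++ʷ⁻ (reverseʷ q) _ e∈rest
      ...   | inj₁ e∈q = All¬⇒¬Any a∉q (endpoint∈vertices j q (∈-edges-reverseʷ⁻ q e∈q))
      ...   | inj₂ (here e≡f) = e≢f e≡f

module RootedTree (G : Graph) (tree : IsTree G) (root : Fin (Graph.n G)) where
  open Graph G
  open WalkProperties G
  open AcyclicProperties G (proj₂ tree)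
  open ≡ using (refl; sym; cong₂; module ≡-Reasoning)
  open import Data.List.Membership.DecPropositional (_≟_ {n}) using () renaming (_∈?_ to _∈ᵛ?_)

  toRoot : ∀ v → Walk G v root
  toRoot v = proj₁ (proj₁ tree v root)

  toRoot-path : ∀ v → IsPath G (toRoot v)
  toRoot-path v = proj₂ (proj₁ tree v root)

  branch : Fin n → List (Fin m)
  branch v = edges G (toRoot v)

  branch-path : ∀ {v} (p : Walk G v root) → IsPath G p → edges G p ≡ branch v
  branch-path {v} p p-path = unique-path p (toRoot v) p-path (toRoot-path v)

  ∉-branch-root : ∀ {e} → e ∉ branch root
  ∉-branch-root e∈ with subst (_ ∈_) (sym (branch-path [] ([] ∷ []))) e∈
  ... | ()

  branch-edge : ∀ f → branch (source f) ≡ f ∷ branch (target f)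
                    ⊎ branch (target f) ≡ f ∷ branch (source f)
  branch-edge f with source f ∈ᵛ? vertices G (toRoot (target f))
  ... | no s∉ = inj₁ (sym (branch-path (f ∷⟨ inj₁ refl ⟩ toRoot (target f))
                                       (¬Any⇒All¬ _ s∉ ∷ toRoot-path (target f))))
  ... | yes s∈ = inj₂ (begin
    branch (target f)                ≡⟨ edges-split ⟩
    edges G prefix ++ edges G suffix ≡⟨ cong₂ _++_ prefix-edges (branch-path suffix suffix-path) ⟩
    f ∷ branch (source f)            ∎)
    where
      open ≡-Reasoning
      open PathSplit (splitPath (toRoot (target f)) (toRoot-path (target f)) s∈)
      t∉[s] : target f ∉ source f ∷ []
      t∉[s] (here t≡s) = no-self-loop f (sym t≡s)
      prefix-edges : edges G prefix ≡ f ∷ []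
      prefix-edges = unique-path prefix (f ∷⟨ inj₂ refl ⟩ []) prefix-path (¬Any⇒All¬ _ t∉[s] ∷ [] ∷ [])

module RestrictedSums {c ℓ p : Level} (R : CommutativeRing c ℓ) (G : Graph)
                      (α : EdgeLabeling {p = p} R G) (cut : Fin (Graph.n G) → List (Fin (Graph.m G))) where
  open CommutativeRing R
  open Graph G
  open WalkProperties G using (source; target)
  open import Data.List.Membership.DecPropositional (_≟_ {m}) using () renaming (_∈?_ to _∈ᵉ?_)
  open import Algebra.Properties.Ring ring using (-1*x≈-x)
  open import Algebra.Properties.AbelianGroup +-abelianGroup using (⁻¹-∙-comm; ⁻¹-anti-homo‿-)
  open import Algebra.Properties.Group +-group using (ε⁻¹≈ε)
  open import Algebra.Properties.CommutativeSemigroup +-commutativeSemigroup using (interchange)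

  infix 4 _∈ᵢ_
  _∈ᵢ_ : Carrier → Ideal R p → Set p
  x ∈ᵢ I = Ideal._∈I I x

  x-0≈x : ∀ x → x - 0# ≈ x
  x-0≈x x = trans (+-cong refl ε⁻¹≈ε) (+-identityʳ x)

  [a+b]-[c+d]≈[a-c]+[b-d] : ∀ a b c d → (a + b) - (c + d) ≈ (a - c) + (b - d)
  [a+b]-[c+d]≈[a-c]+[b-d] a b c d = trans (+-cong refl (sym (⁻¹-∙-comm c d))) (interchange a b (- c) (- d))

  x-x∈ : ∀ I x → x - x ∈ᵢ I
  x-x∈ I x = Ideal.resp I (sym (-‿inverseʳ x)) (Ideal.0∈ I)

  -‿closed : ∀ I {x} → x ∈ᵢ I → - x ∈ᵢ I
  -‿closed I {x} x∈ = Ideal.resp I (-1*x≈-x x) (Ideal.*-closed I (- 1#) x∈)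

  keepIf : ∀ {q} {A : Set q} → Dec A → Carrier → Carrier
  keepIf (yes _) y = y
  keepIf (no _)  _ = 0#

  keepIf-step : ∀ {e f y} {E F : List (Fin m)} → E ≡ f ∷ F → y ∈ᵢ α e →
                (d : Dec (e ∈ E)) (d′ : Dec (e ∈ F)) → keepIf d y - keepIf d′ y ∈ᵢ α f
  keepIf-step {f = f} {y} ≡.refl y∈ (yes _)               (yes _)   = x-x∈ (α f) y
  keepIf-step {e} {y = y} ≡.refl y∈ (yes (here ≡.refl))   (no _)    = Ideal.resp (α e) (sym (x-0≈x y)) y∈
  keepIf-step             ≡.refl y∈ (yes (there e∈F))     (no e∉F)  = ⊥-elim (e∉F e∈F)
  keepIf-step             ≡.refl y∈ (no e∉E)              (yes e∈F) = ⊥-elim (e∉E (there e∈F))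
  keepIf-step {f = f}     ≡.refl y∈ (no _)                (no _)    = x-x∈ (α f) 0#

  restrictedSum : ∀ {s t z} (Q : Walk G s t) → InPathIdeal R G α Q z → Fin n → Carrier
  restrictedSum []           _                 v = 0#
  restrictedSum (e ∷⟨ _ ⟩ Q) (y , _ , _ , D , _) v = keepIf (e ∈ᵉ? cut v) y + restrictedSum Q D v

  restrictedSum-full : ∀ {s t z} (Q : Walk G s t) (D : InPathIdeal R G α Q z) v →
                       edges G Q ⊆ cut v → restrictedSum Q D v ≈ z
  restrictedSum-full [] (Level.lift z≈0) v _ = sym z≈0
  restrictedSum-full (e ∷⟨ _ ⟩ Q) (y , _ , _ , D , z≈y+z′) v Q⊆cut with e ∈ᵉ? cut v
  ... | yes _   = trans (+-cong refl (restrictedSum-full Q D v (Q⊆cut ∘′ there))) (sym z≈y+z′)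
  ... | no e∉ = ⊥-elim (e∉ (Q⊆cut (here ≡.refl)))

  restrictedSum-disjoint : ∀ {s t z} (Q : Walk G s t) (D : InPathIdeal R G α Q z) v →
                           (∀ {e} → e ∈ edges G Q → e ∉ cut v) → restrictedSum Q D v ≈ 0#
  restrictedSum-disjoint [] _ v _ = refl
  restrictedSum-disjoint (e ∷⟨ _ ⟩ Q) (y , _ , _ , D , _) v disjoint with e ∈ᵉ? cut v
  ... | yes e∈ = ⊥-elim (disjoint (here ≡.refl) e∈)
  ... | no _   = trans (+-identityˡ _) (restrictedSum-disjoint Q D v (disjoint ∘′ there))

  restrictedSum-step : ∀ {s t z f a b} (Q : Walk G s t) (D : InPathIdeal R G α Q z) →
                       cut a ≡ f ∷ cut b → restrictedSum Q D a - restrictedSum Q D b ∈ᵢ α f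
  restrictedSum-step {f = f} [] _ _ = x-x∈ (α f) 0#
  restrictedSum-step {f = f} {a} {b} (e ∷⟨ _ ⟩ Q) (y , _ , y∈ , D , _) cut-a =
    Ideal.resp (α f) (sym ([a+b]-[c+d]≈[a-c]+[b-d] _ _ _ _))
      (Ideal.+-closed (α f) (keepIf-step cut-a y∈ (e ∈ᵉ? cut a) (e ∈ᵉ? cut b))
                            (restrictedSum-step Q D cut-a))

  restrictedSum-spline : ∀ {s t z} (Q : Walk G s t) (D : InPathIdeal R G α Q z) →
    (∀ f → cut (source f) ≡ f ∷ cut (target f) ⊎ cut (target f) ≡ f ∷ cut (source f)) →
    IsSpline R G α (restrictedSum Q D)
  restrictedSum-spline Q D cut-edge f with cut-edge f
  ... | inj₁ cut-s = restrictedSum-step Q D cut-s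
  ... | inj₂ cut-t = Ideal.resp (α f) (⁻¹-anti-homo‿- _ _) (-‿closed (α f) (restrictedSum-step Q D cut-t))

  restrictedSum-difference : ∀ {s t z} (Q : Walk G s t) (D : InPathIdeal R G α Q z) u w →
    edges G Q ⊆ cut u → (∀ {e} → e ∈ edges G Q → e ∉ cut w) →
    restrictedSum Q D u - restrictedSum Q D w ≈ z
  restrictedSum-difference Q D u w Q⊆cut-u disjoint =
    trans (+-cong (restrictedSum-full Q D u Q⊆cut-u) (-‿cong (restrictedSum-disjoint Q D w disjoint)))
          (x-0≈x _)

mainTheorem3 : ∀ {c ℓ p : Level} (R : CommutativeRing c ℓ) (G : Graph) →
               IsTree G → (α : EdgeLabeling {p = p} R G) → UDP R G α
mainTheorem3 R G tree α u w (P , P-path) x x∈αP =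
  restrictedSum P D , restrictedSum-spline P D branch-edge ,
  restrictedSum-difference P D u w P⊆branch-u (λ _ → ∉-branch-root)
  where
    open RootedTree G tree w
    open RestrictedSums R G α branch
    D : InPathIdeal R G α P x
    D = x∈αP (P , P-path)
    P⊆branch-u : edges G P ⊆ branch u
    P⊆branch-u = subst (_ ∈_) (branch-path P P-path)
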